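{- Let $d\ge3$ be odd, $\lambda$ a bar partition and $q=\bar q_d(\lambda)$. For every hook $z\in B(D(q))$ we have $\bar h(z)=\bar h(z^*)$. In particular, for all $0\le i,j\le d-1$, the multiset $\{\bar h(z)\mid z\in B_{i\to j}(D(q))\}$ equals the multiset $\{\bar h(w)\mid w\in NB_{j^*\to i^*}(D(q))\}$.
   Context: For a bar partition $\mu=(a_1>\dots>a_m>0)$ (distinct parts), $D(\mu)$ is the partition with Frobenius symbol $(a_1,\dots,a_m\mid a_1-1,\dots,a_m-1)$; for $r\le m$, row $r$ has length $a_r+r$ and column $r$ has length $a_r+r-1$. Young diagrams are in English convention, with node $(r,c)$ in row $r$, column $c$. The hook at $(r,c)$ of a partition $\nu$ has length $h=\nu_r-c+\nu'_c-r+1$, hand node $(r,\nu_r)$ and foot node $(\nu'_c,c)$. Node residue is $[c-r]_d$, the least non-negative residue mod $d$. $H_{i\to j}(\nu)$ is the set of hooks with hand residue $i$ and foot residue $[j+1]_d$. In $D(\mu)$: - $B(D(\mu))$ is the set of hooks at the nodes $(r,c)$ with $r\le m$, $r<c\le r+a_r$, $c\ne m+1$; - $NB(D(\mu))$ is the set of hooks at the nodes $(r,c)$ with $r>c$; - for $X\in\{B,NB\}$, $X_{i\to j}=X\cap H_{i\to j}$. For $z$ at $(r,c)\in B(D(\mu))$, $z^*$ is the hook at $(c,r)$ if $c\le m$, and at $(c-1,r)$ if $c\ge m+2$. Also $i^*=d-i$ for $1\le i\le d-1$, and $0^*=0$. For a partition $\nu$, its minimally normalized $\beta$-set is $X=\{\nu_s+k-s\mid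 1\le s\le k\}$, where $k$ is the least multiple of $d$ that is at least the number of nonzero parts. Runner $i$ is $\{x\in X: x\equiv i \bmod d\}$. The $d$-quotient is the tuple of partitions with $\beta$-sets $\{(x-i)/d\}$ from runner $i$. $\bar q_d(\lambda)$ is the unique bar partition $\mu$ such that $D(\mu)$ has empty $d$-core and the same $d$-quotient as $D(\lambda)$. $x_i$ is the number of beads on runner $i$ of the minimally normalized $d$-abacus of $D(\lambda)$. For $z\in H_{i\to j}(D(q))$, the modified length is $\bar h(z)=h(z)+(x_i-x_j)d$. -}

module Defs where

open import Data.Nat using (ℕ; zero; suc; _+_; _*_; _∸_; _≤_; _<_; _≤ᵇ_; _<ᵇ_; _≡ᵇ_; NonZero; _⊓_)
open import Data.Nat.DivMod using (_/_; _%_)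
open import Data.Integer as ℤ using (ℤ; +_)
open import Data.Integer.DivMod using (_%ℕ_)
open import Data.Bool using (Bool; true; false; if_then_else_)
open import Data.List using (List; []; _∷_; length; map; filter; filterᵇ; applyUpTo; concatMap; concat; zip; _++_)
open import Data.List.Relation.Unary.All using (All)
open import Data.List.Relation.Unary.Linked using (Linked)
open import Data.Product using (_×_; _,_)
open import Relation.Binary.PropositionalEquality using (_≡_)

-- Partitions are lists of row lengths (weakly decreasing), rows and
-- columns are 1-indexed.  A node is a pair (row , column).

Partition : Set
Partition = List ℕ

Node : Set
Node = ℕ × ℕ

IsBar : List ℕ → Set
IsBar μ = Linked (λ a b → b < a) μ × All (λ a → 0 < a) μ

at : List ℕ → ℕ → ℕ
at []       _             = 0
at (x ∷ xs) zero          = 0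
at (x ∷ xs) (suc zero)    = x
at (x ∷ xs) (suc (suc r)) = at xs (suc r)

indexed : List ℕ → List (ℕ × ℕ)
indexed xs = zip (applyUpTo suc (length xs)) xs

oneTo : ℕ → List ℕ
oneTo n = applyUpTo suc n

row : Partition → ℕ → ℕ
row ν r = at ν r

col : Partition → ℕ → ℕ
col ν c = length (filterᵇ (c ≤ᵇ_) ν)

-- D(μ): Frobenius symbol (a_1,…,a_m | a_1-1,…,a_m-1).
-- Rows r ≤ m have length a_r + r; for r > m, row r consists of the nodes
-- (r,c) with c ≤ m and r ≤ (length of column c) = a_c + c - 1.

colsD : List ℕ → List ℕ
colsD μ = map (λ { (s , a) → a + s ∸ 1 }) (indexed μ)

D : List ℕ → Partition
D μ = map (λ { (r , a) → a + r }) (indexed μ)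
   ++ applyUpTo (λ t → lowRow (suc (length μ) + t)) (at μ 1 ∸ length μ)
  where
  lowRow : ℕ → ℕ
  lowRow r = length (filterᵇ (r ≤ᵇ_) (colsD μ))

-- Hooks (identified with their nodes)

hookLen : Partition → Node → ℕ
hookLen ν (r , c) = (row ν r ∸ c) + (col ν c ∸ r) + 1

res : (d : ℕ) .{{_ : NonZero d}} → Node → ℕ
res d (r , c) = (+ c ℤ.- + r) %ℕ d

handRes : (d : ℕ) .{{_ : NonZero d}} → Partition → Node → ℕ
handRes d ν (r , c) = res d (r , row ν r)

footRes : (d : ℕ) .{{_ : NonZero d}} → Partition → Node → ℕ
footRes d ν (r , c) = res d (col ν c , c)

inH : (d : ℕ) .{{_ : NonZero d}} → Partition → ℕ → ℕ → Node → Bool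
inH d ν i j z = (handRes d ν z ≡ᵇ i) Data.Bool.∧ (footRes d ν z ≡ᵇ ((j + 1) % d))

-- nodes (r,c), r ≤ m, r < c ≤ r + a_r, c ≠ m+1
Bnodes : List ℕ → List Node
Bnodes μ = filterᵇ (λ { (r , c) → Data.Bool.not (c ≡ᵇ suc (length μ)) })
  (concatMap (λ { (r , a) → applyUpTo (λ t → (r , r + suc t)) a }) (indexed μ))

-- nodes (r,c) of ν with r > c
NBnodes : Partition → List Node
NBnodes ν = concatMap (λ r → applyUpTo (λ t → (r , suc t)) ((r ∸ 1) ⊓ row ν r)) (oneTo (length ν))

Bij : (d : ℕ) .{{_ : NonZero d}} → List ℕ → ℕ → ℕ → List Node
Bij d μ i j = filterᵇ (inH d (D μ) i j) (Bnodes μ)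

NBij : (d : ℕ) .{{_ : NonZero d}} → List ℕ → ℕ → ℕ → List Node
NBij d μ i j = filterᵇ (inH d (D μ) i j) (NBnodes (D μ))

starNode : List ℕ → Node → Node
starNode μ (r , c) = if c ≤ᵇ length μ then (c , r) else (c ∸ 1 , r)

starRes : ℕ → ℕ → ℕ
starRes d zero    = zero
starRes d (suc i) = d ∸ suc i

nzParts : Partition → ℕ
nzParts ν = length (filterᵇ (0 <ᵇ_) ν)

kNorm : (d : ℕ) .{{_ : NonZero d}} → Partition → ℕ
kNorm d ν = d * ((nzParts ν + (d ∸ 1)) / d)

betaSet : (d : ℕ) .{{_ : NonZero d}} → Partition → List ℕ
betaSet d ν = map (λ s → row ν s + k ∸ s) (oneTo k)
  where k = kNorm d ν

runner : (d : ℕ) .{{_ : NonZero d}} → Partition → ℕ → List ℕ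
runner d ν i = filterᵇ (λ x → x % d ≡ᵇ i) (betaSet d ν)

beads : (d : ℕ) .{{_ : NonZero d}} → Partition → ℕ → ℕ
beads d ν i = length (runner d ν i)

-- partition with β-set X: each bead y gives the part y - #{beads below y};
-- zero parts are dropped (order of X is kept; decreasing X gives a
-- decreasing partition)
partOfBeta : List ℕ → Partition
partOfBeta X = map (λ y → y ∸ length (filterᵇ (_<ᵇ y) X)) X

nonzero : Partition → Partition
nonzero = filterᵇ (0 <ᵇ_)

quotientComp : (d : ℕ) .{{_ : NonZero d}} → Partition → ℕ → Partition
quotientComp d ν i = nonzero (partOfBeta (map (λ x → (x ∸ i) / d) (runner d ν i)))

quotient : (d : ℕ) .{{_ : NonZero d}} → Partition → List Partition
quotient d ν = applyUpTo (quotientComp d ν) d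

-- d-core: slide all beads on each runner up; the core is the partition
-- of the resulting β-set
coreBeta : (d : ℕ) .{{_ : NonZero d}} → Partition → List ℕ
coreBeta d ν = concat (applyUpTo (λ i → applyUpTo (λ t → i + d * t) (beads d ν i)) d)

EmptyCore : (d : ℕ) .{{_ : NonZero d}} → Partition → Set
EmptyCore d ν = All (_≡ 0) (partOfBeta (coreBeta d ν))

-- modified hook length, with x_i taken from the abacus of D(λ):
-- for z ∈ H_{i→j}(D(q)), h̄(z) = h(z) + (x_i - x_j) d

hbar : (d : ℕ) .{{_ : NonZero d}} → (lam q : List ℕ) → Node → ℤ
hbar d lam q z = + hookLen (D q) z ℤ.+ (+ beads d (D lam) i ℤ.- + beads d (D lam) j) ℤ.* + d
  where
  i = handRes d (D q) z
  j = (footRes d (D q) z + (d ∸ 1)) % d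

-- The map z ↦ z* is a bijection from B(D(q)) onto NB(D(q)) preserving hook lengths, and the
-- hand of z* and the foot of z (likewise the hand of z and the foot of z*) have contents adding
-- up to 1; hence z ∈ H_{i→j} exactly when z* ∈ H_{j*→i*}, and only the correction terms
-- (x_i − x_j)d remain to be compared.  They agree because the abacus of every D(λ) is symmetric,
-- x_r + x_{r*} = 2k/d: the β-numbers of the rows of D(λ) below its m-th row, together with the
-- numbers k − a_i, fill {0, …, k − 1}, while the β-number a_i + k of row i is congruent to
-- −(k − a_i) modulo d.
module Submission where

open import Defs
open import Data.Nat using (ℕ; zero; suc; _+_; _*_; _∸_; _<_; _≤_; z≤n; s≤s; NonZero; _≤ᵇ_; _<ᵇ_; _≡ᵇ_; _⊓_)
open import Data.Nat.Properties
open import Data.Nat.DivMod using (_%_; _/_; m%n<n; %-distribˡ-+; [m+kn]%n≡m%n; m%n%n≡m%n; m<n⇒m%n≡m; [m+n]%n≡m%n; m≡m%n+[m/n]*n; n%n≡0)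
open import Data.Nat.Tactic.RingSolver using (solve-∀)
open import Data.Integer as ℤ using (-[1+_])
open import Data.Integer.DivMod using (_%ℕ_; n%ℕd<d)
import Data.Integer.Properties as ℤ
open import Data.Bool using (Bool; true; false; T; not; if_then_else_; _∧_)
open import Data.Bool.Properties using (∧-comm)
open import Data.List using (List; []; _∷_; length; map; filterᵇ; applyUpTo; upTo; concatMap; zip; _++_)
open import Data.List.Properties using (length-++; filter-++; length-applyUpTo; map-applyUpTo)
open import Data.List.Membership.Propositional using (_∈_)
open import Data.List.Membership.Propositional.Properties using (∈-∃++; ∈-filter⁺; ∈-filter⁻; ∈-applyUpTo⁺; ∈-applyUpTo⁻; ∈-concatMap⁺; ∈-concatMap⁻; ∈-map⁺; ∈-map⁻; ∈-upTo⁺; ∈-++⁻)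
open import Data.List.Membership.Propositional.Properties.WithK using (unique∧set⇒bag)
open import Data.List.Relation.Unary.Any using (here; there)
import Data.List.Relation.Unary.Any.Properties as Any
open import Data.List.Relation.Unary.All using (All; []; _∷_)
import Data.List.Relation.Unary.All as All
import Data.List.Relation.Unary.All.Properties as All
open import Data.List.Relation.Unary.Linked using (Linked; _∷_)
open import Data.List.Relation.Unary.Unique.Propositional using (Unique; []; _∷_)
import Data.List.Relation.Unary.Unique.Propositional.Properties as Unique
open import Data.List.Relation.Binary.BagAndSetEquality using (∼bag⇒↭)
open import Data.List.Relation.Binary.Permutation.Propositional using (_↭_; ↭-refl; ↭-sym; ↭-trans; prep)
import Data.List.Relation.Binary.Permutation.Propositional.Properties as ↭
open import Data.Product using (_×_; _,_; proj₁; proj₂; ∃-syntax)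
open import Data.Sum using (_⊎_; inj₁; inj₂)
open import Data.Empty using (⊥; ⊥-elim)
open import Function using (_∘_; id)
open import Function.Bundles using (mk⇔)
open import Relation.Nullary using (¬_; Dec; yes; no)
open import Relation.Nullary.Decidable using (T?)
open import Relation.Binary.PropositionalEquality using (_≡_; _≢_; refl; sym; trans; cong; cong₂; subst; module ≡-Reasoning)

Bool-ext : ∀ {x y : Bool} → (T x → T y) → (T y → T x) → x ≡ y
Bool-ext {false} {false} _ _ = refl
Bool-ext {false} {true}  _ g = ⊥-elim (g _)
Bool-ext {true}  {false} f _ = ⊥-elim (f _)
Bool-ext {true}  {true}  _ _ = refl

T⇒≡true : ∀ {x} → T x → x ≡ true
T⇒≡true {true} _ = refl

¬T⇒≡false : ∀ {x} → ¬ T x → x ≡ false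
¬T⇒≡false {false} _ = refl
¬T⇒≡false {true}  ¬t = ⊥-elim (¬t _)

≡ᵇ-cong-⇔ : ∀ a b c e → (a ≡ b → c ≡ e) → (c ≡ e → a ≡ b) → (a ≡ᵇ b) ≡ (c ≡ᵇ e)
≡ᵇ-cong-⇔ a b c e f g =
  Bool-ext (≡⇒≡ᵇ c e ∘ f ∘ ≡ᵇ⇒≡ a b) (≡⇒≡ᵇ a b ∘ g ∘ ≡ᵇ⇒≡ c e)

≤ᵇ-cong-⇔ : ∀ a b c e → (a ≤ b → c ≤ e) → (c ≤ e → a ≤ b) → (a ≤ᵇ b) ≡ (c ≤ᵇ e)
≤ᵇ-cong-⇔ a b c e f g = Bool-ext (≤⇒≤ᵇ ∘ f ∘ ≤ᵇ⇒≤ a b) (≤⇒≤ᵇ ∘ g ∘ ≤ᵇ⇒≤ c e)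

≤⇒≤ᵇ≡true : ∀ {a b} → a ≤ b → (a ≤ᵇ b) ≡ true
≤⇒≤ᵇ≡true = T⇒≡true ∘ ≤⇒≤ᵇ

>⇒≤ᵇ≡false : ∀ {a b} → b < a → (a ≤ᵇ b) ≡ false
>⇒≤ᵇ≡false {a} {b} b<a = ¬T⇒≡false (<⇒≱ b<a ∘ ≤ᵇ⇒≤ a b)

≡⇒≡ᵇ≡true : ∀ {a b} → a ≡ b → (a ≡ᵇ b) ≡ true
≡⇒≡ᵇ≡true {a} {b} = T⇒≡true ∘ ≡⇒≡ᵇ a b

≢⇒≡ᵇ≡false : ∀ {a b} → a ≢ b → (a ≡ᵇ b) ≡ false
≢⇒≡ᵇ≡false {a} {b} a≢b = ¬T⇒≡false (a≢b ∘ ≡ᵇ⇒≡ a b)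

count : (ℕ → Bool) → ℕ → ℕ
count P zero    = 0
count P (suc n) = if P 0 then suc (count (P ∘ suc) n) else count (P ∘ suc) n

length-filterᵇ-applyUpTo : ∀ {A : Set} (P : A → Bool) (f : ℕ → A) n →
  length (filterᵇ P (applyUpTo f n)) ≡ count (P ∘ f) n
length-filterᵇ-applyUpTo P f zero = refl
length-filterᵇ-applyUpTo P f (suc n) with P (f 0)
... | true  = cong suc (length-filterᵇ-applyUpTo P (f ∘ suc) n)
... | false = length-filterᵇ-applyUpTo P (f ∘ suc) n

length-filterᵇ-++ : ∀ {A : Set} (P : A → Bool) xs ys →
  length (filterᵇ P (xs ++ ys)) ≡ length (filterᵇ P xs) + length (filterᵇ P ys)
length-filterᵇ-++ P xs ys =
  trans (cong length (filter-++ (T? ∘ P) xs ys)) (length-++ (filterᵇ P xs))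

count-cong : ∀ P Q n → (∀ i → i < n → P i ≡ Q i) → count P n ≡ count Q n
count-cong P Q zero    _  = refl
count-cong P Q (suc n) eq with P 0 | Q 0 | eq 0 (s≤s z≤n)
  | count-cong (P ∘ suc) (Q ∘ suc) n (λ i i<n → eq (suc i) (s≤s i<n))
... | true  | true  | _ | ih = cong suc ih
... | false | false | _ | ih = ih

count-≤ : ∀ P n → count P n ≤ n
count-≤ P zero = z≤n
count-≤ P (suc n) with P 0
... | true  = s≤s (count-≤ (P ∘ suc) n)
... | false = m≤n⇒m≤1+n (count-≤ (P ∘ suc) n)

count-mono : ∀ P Q n → (∀ i → i < n → P i ≡ true → Q i ≡ true) → count P n ≤ count Q n
count-mono P Q zero    _   = z≤n
count-mono P Q (suc n) P⇒Q with P 0 | Q 0 | P⇒Q 0 (s≤s z≤n)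
  | count-mono (P ∘ suc) (Q ∘ suc) n (λ i i<n → P⇒Q (suc i) (s≤s i<n))
... | true  | true  | _    | ih = s≤s ih
... | true  | false | 0⇒Q0 | _  with () ← 0⇒Q0 refl
... | false | true  | _    | ih = m≤n⇒m≤1+n ih
... | false | false | _    | ih = ih

count-+ : ∀ P m n → count P (m + n) ≡ count P m + count (λ i → P (m + i)) n
count-+ P zero    n = refl
count-+ P (suc m) n with P 0
... | true  = cong suc (count-+ (P ∘ suc) m n)
... | false = count-+ (P ∘ suc) m n

count-all : ∀ P n → (∀ i → i < n → P i ≡ true) → count P n ≡ n
count-all P zero    _   = refl
count-all P (suc n) all with P 0 | all 0 (s≤s z≤n)
... | true | _ = cong suc (count-all (P ∘ suc) n (λ i i<n → all (suc i) (s≤s i<n)))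

count-none : ∀ P n → (∀ i → i < n → P i ≡ false) → count P n ≡ 0
count-none P zero    _    = refl
count-none P (suc n) none with P 0 | none 0 (s≤s z≤n)
... | false | _ = count-none (P ∘ suc) n (λ i i<n → none (suc i) (s≤s i<n))

count-prefix : ∀ P n c → c ≤ n → (∀ i → i < c → P i ≡ true) →
  (∀ i → c ≤ i → i < n → P i ≡ false) → count P n ≡ c
count-prefix P n c c≤n below above = begin
  count P n                                         ≡⟨ cong (count P) (sym (m+[n∸m]≡n c≤n)) ⟩
  count P (c + (n ∸ c))                             ≡⟨ count-+ P c (n ∸ c) ⟩
  count P c + count (λ i → P (c + i)) (n ∸ c)       ≡⟨ cong₂ _+_ (count-all P c below) (count-none _ (n ∸ c) above′) ⟩
  c + 0                                             ≡⟨ +-identityʳ c ⟩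
  c                                                 ∎
  where
  open ≡-Reasoning
  above′ : ∀ i → i < n ∸ c → P (c + i) ≡ false
  above′ i i<n∸c = above (c + i) (m≤m+n c i) (subst (c + i <_) (m+[n∸m]≡n c≤n) (+-monoʳ-< c i<n∸c))

count-single : ∀ P n c → c < n → P c ≡ true → (∀ i → i < n → i ≢ c → P i ≡ false) → count P n ≡ 1
count-single P (suc n) zero _ P0 others with P 0 | P0
... | true | _ = cong suc (count-none (P ∘ suc) n (λ i i<n → others (suc i) (s≤s i<n) (λ ())))
count-single P (suc n) (suc c) (s≤s c<n) Pc others with P 0 | others 0 (s≤s z≤n) (λ ())
... | false | _ = count-single (P ∘ suc) n c c<n Pc
                    (λ i i<n i≢c → others (suc i) (s≤s i<n) (i≢c ∘ suc-injective))

module _ {A : Set} where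

  private
    ∈-remove : ∀ (ys : List A) {x zs v} → v ∈ ys ++ x ∷ zs → v ≢ x → v ∈ ys ++ zs
    ∈-remove []       (here p)  v≢x = ⊥-elim (v≢x p)
    ∈-remove []       (there p) _   = p
    ∈-remove (y ∷ ys) (here p)  _   = here p
    ∈-remove (y ∷ ys) (there p) v≢x = there (∈-remove ys p v≢x)

  unique-⊆-length⇒↭ : ∀ {xs ys : List A} → Unique xs → (∀ {v} → v ∈ xs → v ∈ ys) →
    length ys ≤ length xs → xs ↭ ys
  unique-⊆-length⇒↭ {[]}     {[]}    _ _ _ = ↭-refl
  unique-⊆-length⇒↭ {x ∷ xs} {ys} (x∉xs ∷ uxs) xs⊆ys len with ∈-∃++ (xs⊆ys (here refl))
  ... | ys₁ , ys₂ , refl =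
    ↭-trans (prep x (unique-⊆-length⇒↭ uxs ⊆rest len′)) (↭-sym (↭.shift x ys₁ ys₂))
    where
    ⊆rest : ∀ {v} → v ∈ xs → v ∈ ys₁ ++ ys₂
    ⊆rest v∈xs = ∈-remove ys₁ (xs⊆ys (there v∈xs)) (λ v≡x → All.lookup x∉xs v∈xs (sym v≡x))
    len′ : length (ys₁ ++ ys₂) ≤ length xs
    len′ = ≤-pred (subst (_≤ suc (length xs))
      (trans (length-++ ys₁) (trans (+-suc (length ys₁) (length ys₂)) (cong suc (sym (length-++ ys₁))))) len)

Unique-map-injectiveOn : ∀ {A B : Set} (f : A → B) (xs : List A) → Unique xs →
  (∀ {x y} → x ∈ xs → y ∈ xs → f x ≡ f y → x ≡ y) → Unique (map f xs)
Unique-map-injectiveOn f []       _          _   = []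
Unique-map-injectiveOn f (x ∷ xs) (x∉ ∷ uxs) inj =
  fx∉ xs x∉ there ∷ Unique-map-injectiveOn f xs uxs (λ p q → inj (there p) (there q))
  where
  fx∉ : ∀ ys → All (x ≢_) ys → (∀ {y} → y ∈ ys → y ∈ x ∷ xs) → All (f x ≢_) (map f ys)
  fx∉ []       _            _   = []
  fx∉ (y ∷ ys) (x≢y ∷ x∉ys) sub =
    (x≢y ∘ inj (here refl) (sub (here refl))) ∷ fx∉ ys x∉ys (sub ∘ there)

Unique-concatMap-keyed : ∀ {X : Set} (block : X → List (ℕ × ℕ)) (f : ℕ → X) (key : ℕ → ℕ) N →
  (∀ i j → key i ≡ key j → i ≡ j) →
  (∀ i → All (λ z → proj₁ z ≡ key i) (block (f i))) → (∀ i → Unique (block (f i))) →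
  Unique (concatMap block (applyUpTo f N))
Unique-concatMap-keyed block f key zero    _       _      _      = []
Unique-concatMap-keyed block f key (suc N) key-inj keyed unique =
  Unique.++⁺ (unique 0)
    (Unique-concatMap-keyed block (f ∘ suc) (key ∘ suc) N (λ i j → suc-injective ∘ key-inj (suc i) (suc j)) (keyed ∘ suc) (unique ∘ suc))
    disjoint
  where
  disjoint : ∀ {v} → ¬ (v ∈ block (f 0) × v ∈ concatMap block (applyUpTo (f ∘ suc) N))
  disjoint (p , q) with Any.applyUpTo⁻ (f ∘ suc) {N} (∈-concatMap⁻ block q)
  ... | i , _ , r with key-inj 0 (suc i) (trans (sym (All.lookup (keyed 0) p)) (All.lookup (keyed (suc i)) r))
  ... | ()

applyUpTo-cong : ∀ {A : Set} (f g : ℕ → A) n → (∀ i → i < n → f i ≡ g i) → applyUpTo f n ≡ applyUpTo g n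
applyUpTo-cong f g zero    _  = refl
applyUpTo-cong f g (suc n) eq =
  cong₂ _∷_ (eq 0 (s≤s z≤n)) (applyUpTo-cong (f ∘ suc) (g ∘ suc) n (λ i i<n → eq (suc i) (s≤s i<n)))

zip-applyUpTo-at : ∀ (f : ℕ → ℕ) xs →
  zip (applyUpTo f (length xs)) xs ≡ applyUpTo (λ i → f i , at xs (suc i)) (length xs)
zip-applyUpTo-at f []       = refl
zip-applyUpTo-at f (x ∷ xs) = cong ((f 0 , x) ∷_) (zip-applyUpTo-at (f ∘ suc) xs)

at-++ˡ : ∀ xs ys i → i < length xs → at (xs ++ ys) (suc i) ≡ at xs (suc i)
at-++ˡ (x ∷ xs) ys zero    _         = refl
at-++ˡ (x ∷ xs) ys (suc i) (s≤s i<) = at-++ˡ xs ys i i<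

at-++ʳ : ∀ xs ys i → at (xs ++ ys) (suc (length xs + i)) ≡ at ys (suc i)
at-++ʳ []       ys i = refl
at-++ʳ (x ∷ xs) ys i = at-++ʳ xs ys i

at-applyUpTo : ∀ (f : ℕ → ℕ) n i → i < n → at (applyUpTo f n) (suc i) ≡ f i
at-applyUpTo f (suc n) zero    _         = refl
at-applyUpTo f (suc n) (suc i) (s≤s i<n) = at-applyUpTo (f ∘ suc) n i i<n

at-≥length : ∀ xs i → length xs ≤ i → at xs (suc i) ≡ 0
at-≥length []       i       _        = refl
at-≥length (x ∷ xs) (suc i) (s≤s l≤) = at-≥length xs i l≤

at-strictly-decreasing : ∀ xs → Linked (λ a b → b < a) xs →
  ∀ i → suc i < length xs → at xs (suc (suc i)) < at xs (suc i)
at-strictly-decreasing (x ∷ y ∷ xs) (y<x ∷ _) zero    _         = y<x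
at-strictly-decreasing (x ∷ y ∷ xs) (_ ∷ l)   (suc i) (s≤s i<) = at-strictly-decreasing (y ∷ xs) l i i<
at-strictly-decreasing (x ∷ [])     _         i       (s≤s ())

at-positive : ∀ xs → All (λ a → 0 < a) xs → ∀ i → i < length xs → 0 < at xs (suc i)
at-positive (x ∷ xs) (0<x ∷ _) zero    _         = 0<x
at-positive (x ∷ xs) (_ ∷ pos) (suc i) (s≤s i<) = at-positive xs pos i i<

+-balance : ∀ x y s t Q → x + s ≡ Q + t → y + t ≡ Q + s → x + y ≡ Q + Q
+-balance x y s t Q x+s≡Q+t y+t≡Q+s = +-cancelʳ-≡ (s + t) (x + y) (Q + Q) (begin
  x + y + (s + t)    ≡⟨ regroup x y s t ⟩
  (x + s) + (y + t)  ≡⟨ cong₂ _+_ x+s≡Q+t y+t≡Q+s ⟩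
  (Q + t) + (Q + s)  ≡⟨ regroup′ Q t s ⟩
  Q + Q + (s + t)    ∎)
  where
  open ≡-Reasoning
  regroup : ∀ x y s t → x + y + (s + t) ≡ (x + s) + (y + t)
  regroup = solve-∀
  regroup′ : ∀ Q t s → (Q + t) + (Q + s) ≡ Q + Q + (s + t)
  regroup′ = solve-∀

m-n≡o-p : ∀ m n o p → m + p ≡ o + n → ℤ.+ m ℤ.- ℤ.+ n ≡ ℤ.+ o ℤ.- ℤ.+ p
m-n≡o-p m n o p m+p≡o+n = begin
  ℤ.+ m ℤ.- ℤ.+ n      ≡⟨ ℤ.m-n≡m⊖n m n ⟩
  m ℤ.⊖ n              ≡⟨ ℤ.+-cancelˡ-⊖ p m n ⟨
  (p + m) ℤ.⊖ (p + n)  ≡⟨ cong₂ ℤ._⊖_ (trans (+-comm p m) (trans m+p≡o+n (+-comm o n))) (+-comm p n) ⟩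
  (n + o) ℤ.⊖ (n + p)  ≡⟨ ℤ.+-cancelˡ-⊖ n o p ⟩
  o ℤ.⊖ p              ≡⟨ ℤ.m-n≡m⊖n o p ⟨
  ℤ.+ o ℤ.- ℤ.+ p      ∎
  where open ≡-Reasoning

map-filterᵇ-↭-transport : ∀ {A B : Set} (s : A → A) (P P′ : A → Bool) (h : A → B) (xs ys : List A) →
  map s xs ↭ ys → (∀ z → z ∈ xs → P′ (s z) ≡ P z) → (∀ z → z ∈ xs → h (s z) ≡ h z) →
  map h (filterᵇ P xs) ↭ map h (filterᵇ P′ ys)
map-filterᵇ-↭-transport s P P′ h xs ys s[xs]↭ys P′∘s≡P h∘s≡h =
  subst (_↭ map h (filterᵇ P′ ys)) (transported xs P′∘s≡P h∘s≡h) (↭.map⁺ h (↭.filter-↭ (T? ∘ P′) s[xs]↭ys))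
  where
  transported : ∀ xs → (∀ z → z ∈ xs → P′ (s z) ≡ P z) → (∀ z → z ∈ xs → h (s z) ≡ h z) →
    map h (filterᵇ P′ (map s xs)) ≡ map h (filterᵇ P xs)
  transported []       _     _     = refl
  transported (x ∷ xs) P′s≡P hs≡h with P′ (s x) | P x | P′s≡P x (here refl)
  ... | true  | true  | _ = cong₂ _∷_ (hs≡h x (here refl)) (transported xs (λ z → P′s≡P z ∘ there) (λ z → hs≡h z ∘ there))
  ... | false | false | _ = transported xs (λ z → P′s≡P z ∘ there) (λ z → hs≡h z ∘ there)

-- (c − r) + (c′ − r′) = 1, stated without subtraction.
ContentsSumToOne : Node → Node → Set
ContentsSumToOne (r , c) (r′ , c′) = c + c′ ≡ r + r′ + 1

handNode footNode : Partition → Node → Node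
handNode ν (r , c) = (r , row ν r)
footNode ν (r , c) = (col ν c , c)

m∸n≡1+[m∸1+n] : ∀ {x c} → c < x → x ∸ c ≡ suc (x ∸ suc c)
m∸n≡1+[m∸1+n] {suc x} {zero}  _         = refl
m∸n≡1+[m∸1+n] {suc x} {suc c} (s≤s c<x) = m∸n≡1+[m∸1+n] c<x

arm+leg-transpose : ∀ X Y i c → c < X → i < Y → (X ∸ c) + (Y ∸ suc i) ≡ (Y ∸ i) + (X ∸ suc c)
arm+leg-transpose X Y i c c<X i<Y rewrite m∸n≡1+[m∸1+n] c<X | m∸n≡1+[m∸1+n] i<Y =
  trans (+-comm (suc (X ∸ suc c)) (Y ∸ suc i)) (+-suc (Y ∸ suc i) (X ∸ suc c))

module Residues (d-1 : ℕ) where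

  d : ℕ
  d = suc d-1

  infix 4 _≈_
  _≈_ : ℕ → ℕ → Set
  a ≈ b = a % d ≡ b % d

  %-≈ : ∀ a → a % d ≈ a
  %-≈ a = m%n%n≡m%n a d

  ≈⇒≡ : ∀ {a b} → a < d → b < d → a ≈ b → a ≡ b
  ≈⇒≡ {a} {b} a<d b<d a≈b = trans (sym (m<n⇒m%n≡m a<d)) (trans a≈b (m<n⇒m%n≡m b<d))

  +-cong-≈ : ∀ {a b c e} → a ≈ b → c ≈ e → a + c ≈ b + e
  +-cong-≈ {a} {b} {c} {e} a≈b c≈e = begin
    (a + c) % d          ≡⟨ %-distribˡ-+ a c d ⟩
    (a % d + c % d) % d  ≡⟨ cong₂ (λ x y → (x + y) % d) a≈b c≈e ⟩
    (b % d + e % d) % d  ≡⟨ %-distribˡ-+ b e d ⟨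
    (b + e) % d          ∎
    where open ≡-Reasoning

  +-cancelʳ-≈ : ∀ a b w → a + w ≈ b + w → a ≈ b
  +-cancelʳ-≈ a b w a+w≈b+w = begin
    a % d                   ≡⟨ [m+kn]%n≡m%n a w d ⟨
    (a + w * d) % d         ≡⟨ cong (_% d) (shift a) ⟩
    (a + w + w * d-1) % d   ≡⟨ +-cong-≈ {a + w} {b + w} {w * d-1} a+w≈b+w refl ⟩
    (b + w + w * d-1) % d   ≡⟨ cong (_% d) (shift b) ⟨
    (b + w * d) % d         ≡⟨ [m+kn]%n≡m%n b w d ⟩
    b % d                   ∎
    where
    open ≡-Reasoning
    shift : ∀ x → x + w * d ≡ x + w + w * d-1
    shift x = trans (cong (x +_) (*-suc w d-1)) (sym (+-assoc x w (w * d-1)))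

  +-cancelˡ-≈ : ∀ a b w → w + a ≈ w + b → a ≈ b
  +-cancelˡ-≈ a b w w+a≈w+b =
    +-cancelʳ-≈ a b w (trans (cong (_% d) (+-comm a w)) (trans w+a≈w+b (cong (_% d) (+-comm w b))))

  -- In ℤ, the residue of -[1+ n ] is 0 or d ∸ (suc n % d).
  %ℕ-negative-+ : ∀ n → -[1+ n ] %ℕ d + suc n ≈ 0
  %ℕ-negative-+ n with suc n % d in eq
  ... | zero   = eq
  ... | suc r′ = begin
    (d ∸ suc r′ + suc n) % d                ≡⟨ cong (λ x → (d ∸ suc r′ + x) % d) (m≡m%n+[m/n]*n (suc n) d) ⟩
    (d ∸ suc r′ + (suc n % d + k * d)) % d  ≡⟨ cong (λ x → (d ∸ suc r′ + (x + k * d)) % d) eq ⟩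
    (d ∸ suc r′ + (suc r′ + k * d)) % d     ≡⟨ cong (_% d) (+-assoc (d ∸ suc r′) (suc r′) (k * d)) ⟨
    (d ∸ suc r′ + suc r′ + k * d) % d       ≡⟨ [m+kn]%n≡m%n (d ∸ suc r′ + suc r′) k d ⟩
    (d ∸ suc r′ + suc r′) % d               ≡⟨ cong (_% d) (m∸n+n≡m r≤d) ⟩
    d % d                                   ≡⟨ n%n≡0 d ⟩
    0                                       ∎
    where
    open ≡-Reasoning
    k = suc n / d
    r≤d : suc r′ ≤ d
    r≤d = <⇒≤ (subst (_< d) eq (m%n<n (suc n) d))

  res-< : ∀ z → res d z < d
  res-< (r , c) = n%ℕd<d (ℤ.+ c ℤ.- ℤ.+ r) d

  res-+ : ∀ r c → res d (r , c) + r ≈ c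
  res-+ r c with r ≤? c
  ... | yes r≤c rewrite ℤ.m-n≡m⊖n c r | ℤ.⊖-≥ r≤c = begin
    ((c ∸ r) % d + r) % d  ≡⟨ +-cong-≈ {(c ∸ r) % d} {c ∸ r} {r} {r} (%-≈ (c ∸ r)) refl ⟩
    (c ∸ r + r) % d        ≡⟨ cong (_% d) (m∸n+n≡m r≤c) ⟩
    c % d                  ∎
    where open ≡-Reasoning
  ... | no r≰c with m≤n⇒∃[o]m+o≡n (≰⇒> r≰c)
  ... | n , refl = subst (λ r → res d (r , c) + r ≈ c) (+-suc c n) (res-+-above c n)
    where
    res-+-above : ∀ c n → res d (c + suc n , c) + (c + suc n) ≈ c
    res-+-above c n rewrite ℤ.m-n≡m⊖n c (c + suc n) | ℤ.⊖-< (m<m+n c {suc n} (s≤s z≤n)) | m+n∸m≡n c (suc n) = begin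
      (-[1+ n ] %ℕ d + (c + suc n)) % d  ≡⟨ cong (λ x → (-[1+ n ] %ℕ d + x) % d) (+-comm c (suc n)) ⟩
      (-[1+ n ] %ℕ d + (suc n + c)) % d  ≡⟨ cong (_% d) (+-assoc (-[1+ n ] %ℕ d) (suc n) c) ⟨
      (-[1+ n ] %ℕ d + suc n + c) % d    ≡⟨ +-cong-≈ { -[1+ n ] %ℕ d + suc n} {0} {c} {c} (%ℕ-negative-+ n) refl ⟩
      c % d                              ∎
      where open ≡-Reasoning

  contents-res : ∀ w w′ → ContentsSumToOne w w′ → res d w + res d w′ ≈ 1
  contents-res (r , c) (r′ , c′) c+c′≡ = +-cancelʳ-≈ (u + u′) 1 (r + r′) (begin
    (u + u′ + (r + r′)) % d    ≡⟨ cong (_% d) (regroup u u′ r r′) ⟩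
    ((u + r) + (u′ + r′)) % d  ≡⟨ +-cong-≈ {u + r} {c} {u′ + r′} {c′} (res-+ r c) (res-+ r′ c′) ⟩
    (c + c′) % d               ≡⟨ cong (_% d) (trans c+c′≡ (+-comm (r + r′) 1)) ⟩
    (1 + (r + r′)) % d         ∎)
    where
    open ≡-Reasoning
    u = res d (r , c)
    u′ = res d (r′ , c′)
    regroup : ∀ u u′ r r′ → u + u′ + (r + r′) ≡ (u + r) + (u′ + r′)
    regroup = solve-∀

  ≡ᵇ-complement : ∀ {u v a b} → u < d → v < d → a < d → b < d → u + v ≈ a + b →
    (u ≡ᵇ a) ≡ (v ≡ᵇ b)
  ≡ᵇ-complement {u} {v} {a} {b} u<d v<d a<d b<d uv≈ab = ≡ᵇ-cong-⇔ u a v b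
    (λ { refl → ≈⇒≡ v<d b<d (+-cancelˡ-≈ v b u uv≈ab) })
    (λ { refl → ≈⇒≡ u<d a<d (+-cancelʳ-≈ u a v uv≈ab) })

  starRes-< : ∀ x → starRes d x < d
  starRes-< zero    = s≤s z≤n
  starRes-< (suc x) = s≤s (m∸n≤m d-1 x)

  starRes-+ : ∀ x → x < d → starRes d x + x ≈ 0
  starRes-+ zero    _   = refl
  starRes-+ (suc x) x<d = trans (cong (_% d) (m∸n+n≡m (<⇒≤ x<d))) (n%n≡0 d)

  -- [v − 1]_d: how hbar recovers j from a foot residue [j + 1]_d.
  predRes : ℕ → ℕ
  predRes v = (v + d-1) % d

  predRes-< : ∀ v → predRes v < d
  predRes-< v = m%n<n (v + d-1) d

  predRes-+1 : ∀ v → predRes v + 1 ≈ v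
  predRes-+1 v = begin
    ((v + d-1) % d + 1) % d  ≡⟨ +-cong-≈ {(v + d-1) % d} {v + d-1} {1} {1} (%-≈ (v + d-1)) refl ⟩
    (v + d-1 + 1) % d        ≡⟨ cong (_% d) (trans (+-assoc v d-1 1) (cong (v +_) (+-comm d-1 1))) ⟩
    (v + d) % d              ≡⟨ [m+n]%n≡m%n v d ⟩
    v % d                    ∎
    where open ≡-Reasoning

  sucRes : ℕ → ℕ
  sucRes j = (j + 1) % d

  sucRes-< : ∀ j → sucRes j < d
  sucRes-< j = m%n<n (j + 1) d

  starRes-+-suc : ∀ j → j < d → starRes d j + (j + 1) ≈ 1
  starRes-+-suc j j<d = begin
    (starRes d j + (j + 1)) % d  ≡⟨ cong (_% d) (+-assoc (starRes d j) j 1) ⟨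
    (starRes d j + j + 1) % d    ≡⟨ +-cong-≈ {starRes d j + j} {0} {1} {1} (starRes-+ j j<d) refl ⟩
    1 % d                        ∎
    where open ≡-Reasoning

  starRes-+-sucRes : ∀ j → j < d → starRes d j + sucRes j ≈ 1
  starRes-+-sucRes j j<d =
    trans (+-cong-≈ {starRes d j} {starRes d j} {sucRes j} {j + 1} refl (%-≈ (j + 1))) (starRes-+-suc j j<d)

  starRes-involutive : ∀ x → x < d → starRes d (starRes d x) ≡ x
  starRes-involutive x x<d = ≈⇒≡ (starRes-< (starRes d x)) x<d
    (+-cancelʳ-≈ (starRes d (starRes d x)) x (starRes d x) (trans (starRes-+ (starRes d x) (starRes-< x))
      (sym (trans (cong (_% d) (+-comm x (starRes d x))) (starRes-+ x x<d)))))

  +-sucRes-starRes : ∀ i → i < d → i + sucRes (starRes d i) ≈ 1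
  +-sucRes-starRes i i<d = subst (λ x → x + sucRes (starRes d i) ≈ 1) (starRes-involutive i i<d)
    (starRes-+-sucRes (starRes d i) (starRes-< i))

  ≡-starRes-predRes : ∀ {u v} → u < d → u + v ≈ 1 → u ≡ starRes d (predRes v)
  ≡-starRes-predRes {u} {v} u<d u+v≈1 = ≈⇒≡ u<d (starRes-< (predRes v))
    (+-cancelʳ-≈ u (starRes d (predRes v)) v (trans u+v≈1 (sym starPred+v≈1)))
    where
    starPred+v≈1 : starRes d (predRes v) + v ≈ 1
    starPred+v≈1 = begin
      (starRes d (predRes v) + v) % d            ≡⟨ +-cong-≈ {starRes d (predRes v)} {starRes d (predRes v)} {v} {predRes v + 1} refl (sym (predRes-+1 v)) ⟩
      (starRes d (predRes v) + (predRes v + 1)) % d  ≡⟨ starRes-+-suc (predRes v) (predRes-< v) ⟩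
      1 % d                                      ∎
      where open ≡-Reasoning

module Runners (d-1 : ℕ) where
  open Residues d-1

  onRunner : ℕ → ℕ → Bool
  onRunner r x = x % d ≡ᵇ r

  ≤-roundUp : ∀ N → N ≤ d * ((N + d-1) / d)
  ≤-roundUp N = subst (N ≤_) (*-comm ((N + d-1) / d) d) (+-cancelʳ-≤ d-1 N _ (begin
    N + d-1                                  ≡⟨ m≡m%n+[m/n]*n (N + d-1) d ⟩
    (N + d-1) % d + (N + d-1) / d * d        ≤⟨ +-monoˡ-≤ _ (≤-pred (m%n<n (N + d-1) d)) ⟩
    d-1 + (N + d-1) / d * d                  ≡⟨ +-comm d-1 _ ⟩
    (N + d-1) / d * d + d-1                  ∎))
    where open ≤-Reasoning

  count-onRunner-multiple : ∀ r → r < d → ∀ Q → count (onRunner r) (d * Q) ≡ Q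
  count-onRunner-multiple r r<d zero    = subst (λ x → count (onRunner r) x ≡ 0) (sym (*-zeroʳ d)) refl
  count-onRunner-multiple r r<d (suc Q) = begin
    count (onRunner r) (d * suc Q)                                    ≡⟨ cong (count (onRunner r)) (*-suc d Q) ⟩
    count (onRunner r) (d + d * Q)                                    ≡⟨ count-+ (onRunner r) d (d * Q) ⟩
    count (onRunner r) d + count (λ x → onRunner r (d + x)) (d * Q)   ≡⟨ cong₂ _+_ once periodic ⟩
    1 + Q                                                             ∎
    where
    open ≡-Reasoning
    once : count (onRunner r) d ≡ 1
    once = count-single (onRunner r) d r r<d (≡⇒≡ᵇ≡true (m<n⇒m%n≡m r<d))
      (λ i i<d i≢r → ≢⇒≡ᵇ≡false (i≢r ∘ trans (sym (m<n⇒m%n≡m i<d))))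
    periodic : count (λ x → onRunner r (d + x)) (d * Q) ≡ Q
    periodic = trans (count-cong _ _ (d * Q) (λ x _ → cong (_≡ᵇ r) (trans (cong (_% d) (+-comm d x)) ([m+n]%n≡m%n x d))))
      (count-onRunner-multiple r r<d Q)

  onRunner-complement : ∀ x y r s → r < d → s < d → x + y ≈ r + s → onRunner r x ≡ onRunner s y
  onRunner-complement x y r s r<d s<d x+y≈r+s = ≡ᵇ-complement (m%n<n x d) (m%n<n y d) r<d s<d
    (trans (+-cong-≈ {x % d} {x} {y % d} {y} (%-≈ x) (%-≈ y)) x+y≈r+s)

module ShapeOfD (μ : List ℕ) (bar : IsBar μ) where

  m : ℕ
  m = length μ

  -- Parts are indexed from 0: a i is the part a_{i+1} of the paper.
  a : ℕ → ℕ
  a i = at μ (suc i)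

  a-suc-< : ∀ i → suc i < m → a (suc i) < a i
  a-suc-< = at-strictly-decreasing μ (proj₁ bar)

  a-positive : ∀ i → i < m → 0 < a i
  a-positive = at-positive μ (proj₂ bar)

  a-≥m : ∀ i → m ≤ i → a i ≡ 0
  a-≥m = at-≥length μ

  a-anti-< : ∀ i j → i < j → j < m → a j < a i
  a-anti-< i (suc j) i<1+j 1+j<m with m≤n⇒m<n∨m≡n (≤-pred i<1+j)
  ... | inj₂ refl = a-suc-< i 1+j<m
  ... | inj₁ i<j  = <-trans (a-suc-< j 1+j<m) (a-anti-< i j i<j (<-trans (n<1+n j) 1+j<m))

  a+i-anti : ∀ i j → i ≤ j → j < m → a j + j ≤ a i + i
  a+i-anti i j i≤j j<m with m≤n⇒m<n∨m≡n i≤j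
  ... | inj₂ refl = ≤-refl
  ... | inj₁ i<j with j | i<j
  ...   | suc j′ | s≤s i≤j′ = ≤-trans a+1+j′≤a+j′ (a+i-anti i j′ i≤j′ (<-trans (n<1+n j′) j<m))
    where
    a+1+j′≤a+j′ : a (suc j′) + suc j′ ≤ a j′ + j′
    a+1+j′≤a+j′ = subst (_≤ a j′ + j′) (sym (+-suc (a (suc j′)) j′)) (+-monoˡ-≤ j′ (a-suc-< j′ j<m))

  a+i≤a₀ : ∀ i → i < m → a i + i ≤ a 0
  a+i≤a₀ i i<m = subst (a i + i ≤_) (+-identityʳ (a 0)) (a+i-anti 0 i z≤n i<m)

  m≤a+i : ∀ i → i < m → m ≤ a i + i
  m≤a+i i i<m = go (m ∸ suc i) i (m+[n∸m]≡n i<m)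
    where
    go : ∀ k i → suc i + k ≡ m → m ≤ a i + i
    go zero    i 1+i+0≡m = subst (_≤ a i + i) (trans (cong suc (sym (+-identityʳ i))) 1+i+0≡m)
      (+-monoˡ-≤ i (a-positive i (subst (i <_) 1+i+0≡m (s≤s (≤-reflexive (sym (+-identityʳ i)))))))
    go (suc k) i 1+i+1+k≡m = ≤-trans (go k (suc i) (trans (cong suc (sym (+-suc i k))) 1+i+1+k≡m))
      (a+i-anti i (suc i) (n≤1+n i) (subst (suc i <_) 1+i+1+k≡m (s≤s (m<m+n i (s≤s z≤n)))))

  -- Column c + 1 ≤ m of D(μ) has length a c + c, so this counts the first m columns of length ≥ R.
  colsAtLeast : ℕ → ℕ
  colsAtLeast R = count (λ i → R ≤ᵇ a i + i) m

  colsAtLeast-≤ : ∀ R → colsAtLeast R ≤ m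
  colsAtLeast-≤ R = count-≤ _ m

  <colsAtLeast : ∀ R c → c < m → R ≤ a c + c → c < colsAtLeast R
  <colsAtLeast R c c<m R≤ = begin
    suc c                                              ≡⟨ count-all P (suc c) (λ i i≤c → ≤⇒≤ᵇ≡true (≤-trans R≤ (a+i-anti i c (≤-pred i≤c) c<m))) ⟨
    count P (suc c)                                    ≤⟨ m≤m+n (count P (suc c)) _ ⟩
    count P (suc c) + count (λ i → P (suc c + i)) (m ∸ suc c) ≡⟨ count-+ P (suc c) (m ∸ suc c) ⟨
    count P (suc c + (m ∸ suc c))                      ≡⟨ cong (count P) (m+[n∸m]≡n c<m) ⟩
    colsAtLeast R                                      ∎
    where
    open ≤-Reasoning
    P = λ i → R ≤ᵇ a i + i

  colsAtLeast-≤-index : ∀ R c → c < m → a c + c < R → colsAtLeast R ≤ c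
  colsAtLeast-≤-index R c c<m a+c<R = begin
    colsAtLeast R                                   ≡⟨ cong (count P) (sym (m+[n∸m]≡n (<⇒≤ c<m))) ⟩
    count P (c + (m ∸ c))                           ≡⟨ count-+ P c (m ∸ c) ⟩
    count P c + count (λ i → P (c + i)) (m ∸ c)     ≡⟨ cong (count P c +_) (count-none _ (m ∸ c) beyond) ⟩
    count P c + 0                                   ≡⟨ +-identityʳ _ ⟩
    count P c                                       ≤⟨ count-≤ P c ⟩
    c                                               ∎
    where
    open ≤-Reasoning
    P = λ i → R ≤ᵇ a i + i
    beyond : ∀ i → i < m ∸ c → P (c + i) ≡ false
    beyond i i< = >⇒≤ᵇ≡false (≤-<-trans (a+i-anti c (c + i) (m≤m+n c i)
      (subst (c + i <_) (m+[n∸m]≡n (<⇒≤ c<m)) (+-monoʳ-< c i<))) a+c<R)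

  <colsAtLeast⁻ : ∀ R c → c < m → c < colsAtLeast R → R ≤ a c + c
  <colsAtLeast⁻ R c c<m c<cols with R ≤? a c + c
  ... | yes R≤ = R≤
  ... | no  R≰ = ⊥-elim (<⇒≱ c<cols (colsAtLeast-≤-index R c c<m (≰⇒> R≰)))

  colsAtLeast-> : ∀ R → a 0 < R → colsAtLeast R ≡ 0
  colsAtLeast-> R a₀<R = count-none _ m (λ i i<m → >⇒≤ᵇ≡false (≤-<-trans (a+i≤a₀ i i<m) a₀<R))

  colsAtLeast-anti : ∀ R R′ → R ≤ R′ → colsAtLeast R′ ≤ colsAtLeast R
  colsAtLeast-anti R R′ R≤R′ =
    count-mono _ _ m (λ i _ R′≤ → ≤⇒≤ᵇ≡true (≤-trans R≤R′ (≤ᵇ⇒≤ R′ _ (subst T (sym R′≤) _))))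

  n : ℕ
  n = a 0 ∸ m

  upperRow lowerRow : ℕ → ℕ
  upperRow i = a i + suc i
  lowerRow t = colsAtLeast (suc m + t)

  length-filter-colsD : ∀ R → length (filterᵇ (R ≤ᵇ_) (colsD μ)) ≡ colsAtLeast R
  length-filter-colsD R = begin
    length (filterᵇ (R ≤ᵇ_) (colsD μ))
      ≡⟨ cong (λ x → length (filterᵇ (R ≤ᵇ_) (map (λ { (s , b) → b + s ∸ 1 }) x))) (zip-applyUpTo-at suc μ) ⟩
    length (filterᵇ (R ≤ᵇ_) (map (λ { (s , b) → b + s ∸ 1 }) (applyUpTo (λ i → suc i , a i) m)))
      ≡⟨ cong (length ∘ filterᵇ (R ≤ᵇ_)) (map-applyUpTo _ _ m) ⟩
    length (filterᵇ (R ≤ᵇ_) (applyUpTo (λ i → a i + suc i ∸ 1) m))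
      ≡⟨ length-filterᵇ-applyUpTo (R ≤ᵇ_) _ m ⟩
    count (λ i → R ≤ᵇ (a i + suc i ∸ 1)) m
      ≡⟨ count-cong _ _ m (λ i _ → cong (λ x → R ≤ᵇ (x ∸ 1)) (+-suc (a i) i)) ⟩
    colsAtLeast R ∎
    where open ≡-Reasoning

  D-shape : D μ ≡ applyUpTo upperRow m ++ applyUpTo lowerRow n
  D-shape = cong₂ _++_ upper (applyUpTo-cong _ _ n (λ t _ → length-filter-colsD (suc m + t)))
    where
    upper : map (λ { (r , b) → b + r }) (indexed μ) ≡ applyUpTo upperRow m
    upper = trans (cong (map (λ { (r , b) → b + r })) (zip-applyUpTo-at suc μ)) (map-applyUpTo _ _ m)

  length-D : length (D μ) ≡ m + n
  length-D = begin
    length (D μ)                                                 ≡⟨ cong length D-shape ⟩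
    length (applyUpTo upperRow m ++ applyUpTo lowerRow n)        ≡⟨ length-++ (applyUpTo upperRow m) ⟩
    length (applyUpTo upperRow m) + length (applyUpTo lowerRow n) ≡⟨ cong₂ _+_ (length-applyUpTo upperRow m) (length-applyUpTo lowerRow n) ⟩
    m + n                                                        ∎
    where open ≡-Reasoning

  row-upper : ∀ i → i < m → row (D μ) (suc i) ≡ a i + suc i
  row-upper i i<m rewrite D-shape = trans
    (at-++ˡ (applyUpTo upperRow m) (applyUpTo lowerRow n) i (subst (i <_) (sym (length-applyUpTo upperRow m)) i<m))
    (at-applyUpTo upperRow m i i<m)

  row-lower : ∀ R → m < R → row (D μ) R ≡ colsAtLeast R
  row-lower (suc R) (s≤s m≤R) rewrite D-shape | sym (m+[n∸m]≡n m≤R) = trans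
    (subst (λ l → at (applyUpTo upperRow m ++ applyUpTo lowerRow n) (suc (l + t)) ≡ at (applyUpTo lowerRow n) (suc t))
      (length-applyUpTo upperRow m) (at-++ʳ (applyUpTo upperRow m) (applyUpTo lowerRow n) t))
    lower
    where
    t = R ∸ m
    lower : at (applyUpTo lowerRow n) (suc t) ≡ colsAtLeast (suc (m + t))
    lower with t <? n
    ... | yes t<n = at-applyUpTo lowerRow n t t<n
    ... | no  t≮n = trans (at-≥length (applyUpTo lowerRow n) t (subst (_≤ t) (sym (length-applyUpTo lowerRow n)) (≮⇒≥ t≮n)))
      (sym (colsAtLeast-> (suc (m + t)) (s≤s (≤-trans (m≤n+m∸n (a 0) m) (+-monoʳ-≤ m (≮⇒≥ t≮n))))))

  col-D : ∀ x → col (D μ) x ≡ count (λ i → x ≤ᵇ upperRow i) m + count (λ t → x ≤ᵇ lowerRow t) n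
  col-D x rewrite D-shape = trans (length-filterᵇ-++ (x ≤ᵇ_) (applyUpTo upperRow m) (applyUpTo lowerRow n))
    (cong₂ _+_ (length-filterᵇ-applyUpTo (x ≤ᵇ_) upperRow m) (length-filterᵇ-applyUpTo (x ≤ᵇ_) lowerRow n))

  col-upper : ∀ c → c < m → col (D μ) (suc c) ≡ a c + c
  col-upper c c<m = begin
    col (D μ) (suc c)                                                         ≡⟨ col-D (suc c) ⟩
    count (λ i → suc c ≤ᵇ upperRow i) m + count (λ t → suc c ≤ᵇ lowerRow t) n ≡⟨ cong₂ _+_ upper lower ⟩
    m + (a c + c ∸ m)                                                         ≡⟨ m+[n∸m]≡n (m≤a+i c c<m) ⟩
    a c + c                                                                   ∎
    where
    open ≡-Reasoning
    K = a c + c ∸ m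
    m+K : m + K ≡ a c + c
    m+K = m+[n∸m]≡n (m≤a+i c c<m)
    upper : count (λ i → suc c ≤ᵇ upperRow i) m ≡ m
    upper = count-all _ m (λ i i<m → ≤⇒≤ᵇ≡true (≤-trans c<m (≤-trans (m≤a+i i i<m) (+-monoʳ-≤ (a i) (n≤1+n i)))))
    lower : count (λ t → suc c ≤ᵇ lowerRow t) n ≡ K
    lower = trans (count-cong _ _ n (λ t _ → ≤ᵇ-cong-⇔ (suc c) (lowerRow t) (suc m + t) (a c + c)
                 (<colsAtLeast⁻ (suc m + t) c c<m) (<colsAtLeast (suc m + t) c c<m)))
      (count-prefix _ n K (∸-monoˡ-≤ m (a+i≤a₀ c c<m))
        (λ t t<K → ≤⇒≤ᵇ≡true (subst (suc m + t ≤_) m+K (+-monoʳ-< m t<K)))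
        (λ t K≤t _ → >⇒≤ᵇ≡false (s≤s (subst (_≤ m + t) m+K (+-monoʳ-≤ m K≤t)))))

  col-lower : ∀ c → m ≤ c → col (D μ) (suc c) ≡ colsAtLeast c
  col-lower c m≤c = begin
    col (D μ) (suc c)                                                         ≡⟨ col-D (suc c) ⟩
    count (λ i → suc c ≤ᵇ upperRow i) m + count (λ t → suc c ≤ᵇ lowerRow t) n ≡⟨ cong₂ _+_ upper lower ⟩
    colsAtLeast c + 0                                                         ≡⟨ +-identityʳ _ ⟩
    colsAtLeast c                                                             ∎
    where
    open ≡-Reasoning
    upper : count (λ i → suc c ≤ᵇ upperRow i) m ≡ colsAtLeast c
    upper = count-cong _ _ m (λ i _ → ≤ᵇ-cong-⇔ (suc c) (upperRow i) c (a i + i)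
      (λ 1+c≤ → ≤-pred (subst (suc c ≤_) (+-suc (a i) i) 1+c≤))
      (λ c≤ → subst (suc c ≤_) (sym (+-suc (a i) i)) (s≤s c≤)))
    lower : count (λ t → suc c ≤ᵇ lowerRow t) n ≡ 0
    lower = count-none _ n (λ t _ → >⇒≤ᵇ≡false (s≤s (≤-trans (colsAtLeast-≤ _) m≤c)))

module Star (μ : List ℕ) (bar : IsBar μ) where
  open ShapeOfD μ bar

  bBlock : ℕ × ℕ → List Node
  bBlock (r , b) = applyUpTo (λ t → (r , r + suc t)) b

  notColumn1+m : Node → Bool
  notColumn1+m (r , c) = not (c ≡ᵇ suc m)

  indexed≡ : indexed μ ≡ applyUpTo (λ i → suc i , a i) m
  indexed≡ = zip-applyUpTo-at suc μ

  ∈-Bnodes⁻ : ∀ {z} → z ∈ Bnodes μ →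
    ∃[ i ] ∃[ t ] (i < m × t < a i × z ≡ (suc i , suc (i + suc t)) × i + suc t ≢ m)
  ∈-Bnodes⁻ {z} z∈ with ∈-filter⁻ (T? ∘ notColumn1+m) {xs = concatMap bBlock (indexed μ)} z∈
  ... | z∈blocks , z-ok with Any.applyUpTo⁻ (λ i → suc i , a i) {m}
                              (∈-concatMap⁻ bBlock (subst (λ x → z ∈ concatMap bBlock x) indexed≡ z∈blocks))
  ... | i , i<m , z∈block with ∈-applyUpTo⁻ (λ t → (suc i , suc i + suc t)) z∈block
  ... | t , t<a , refl = i , t , i<m , t<a , refl , λ c≡m → subst T (cong not (≡⇒≡ᵇ≡true (cong suc c≡m))) z-ok

  ∈-Bnodes⁺ : ∀ i t → i < m → t < a i → i + suc t ≢ m → (suc i , suc (i + suc t)) ∈ Bnodes μ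
  ∈-Bnodes⁺ i t i<m t<a c≢m = ∈-filter⁺ (T? ∘ notColumn1+m) {xs = concatMap bBlock (indexed μ)}
    (subst (λ x → (suc i , suc (i + suc t)) ∈ concatMap bBlock x) (sym indexed≡)
      (∈-concatMap⁺ bBlock (Any.applyUpTo⁺ (λ i → suc i , a i) (∈-applyUpTo⁺ (λ t → (suc i , suc i + suc t)) t<a) i<m)))
    column-ok
    where
    column-ok : T (notColumn1+m (suc i , suc (i + suc t)))
    column-ok = subst (T ∘ not) (sym (≢⇒≡ᵇ≡false (c≢m ∘ suc-injective))) _

  Unique-Bnodes : Unique (Bnodes μ)
  Unique-Bnodes = Unique.filter⁺ (T? ∘ notColumn1+m) (subst (λ x → Unique (concatMap bBlock x)) (sym indexed≡)
    (Unique-concatMap-keyed bBlock (λ i → suc i , a i) suc m (λ i j → suc-injective)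
      (λ i → All.applyUpTo⁺₁ _ (a i) (λ _ → refl))
      (λ i → Unique.applyUpTo⁺₁ _ (a i) (λ t<t′ _ eq → <⇒≢ t<t′ (suc-injective (+-cancelˡ-≡ (suc i) _ _ (cong proj₂ eq)))))))

  ν : Partition
  ν = D μ

  nbBlock : ℕ → List Node
  nbBlock r = applyUpTo (λ t → (r , suc t)) ((r ∸ 1) ⊓ row ν r)

  ∈-NBnodes⁻ : ∀ {z} → z ∈ NBnodes ν →
    ∃[ r ] ∃[ t ] (r < length ν × t < r × t < row ν (suc r) × z ≡ (suc r , suc t))
  ∈-NBnodes⁻ z∈ with Any.applyUpTo⁻ suc {length ν} (∈-concatMap⁻ nbBlock z∈)
  ... | r , r< , z∈block with ∈-applyUpTo⁻ (λ t → (suc r , suc t)) z∈block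
  ... | t , t< , refl = r , t , r< , m<n⊓o⇒m<n r _ t< , m<n⊓o⇒m<o r _ t< , refl

  ∈-NBnodes⁺ : ∀ r t → r < length ν → t < r → t < row ν (suc r) → (suc r , suc t) ∈ NBnodes ν
  ∈-NBnodes⁺ r t r< t<r t<row = ∈-concatMap⁺ nbBlock
    (Any.applyUpTo⁺ suc (∈-applyUpTo⁺ (λ t → (suc r , suc t)) (⊓-pres-m< t<r t<row)) r<)

  Unique-NBnodes : Unique (NBnodes ν)
  Unique-NBnodes = Unique-concatMap-keyed nbBlock suc suc (length ν) (λ i j → suc-injective)
    (λ r → All.applyUpTo⁺₁ _ _ (λ _ → refl))
    (λ r → Unique.applyUpTo⁺₁ _ _ (λ t<t′ _ eq → <⇒≢ t<t′ (suc-injective (cong proj₂ eq))))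

  star-upper : ∀ r c → c < m → starNode μ (r , suc c) ≡ (suc c , r)
  star-upper r c c<m rewrite ≤⇒≤ᵇ≡true {suc c} {m} c<m = refl

  star-lower : ∀ r c → m < c → starNode μ (r , suc c) ≡ (c , r)
  star-lower r c m<c rewrite >⇒≤ᵇ≡false {suc c} {m} (≤-trans m<c (n≤1+n c)) = refl

  <⊎> : ∀ c → c ≢ m → c < m ⊎ m < c
  <⊎> c c≢m with c <? m
  ... | yes c<m = inj₁ c<m
  ... | no  c≮m = inj₂ (≤∧≢⇒< (≮⇒≥ c≮m) (c≢m ∘ sym))

  m≤length-D : m ≤ length ν
  m≤length-D = subst (m ≤_) (sym length-D) (m≤m+n m n)

  a₀≤length-D : a 0 ≤ length ν
  a₀≤length-D = subst (a 0 ≤_) (sym length-D) (m≤n+m∸n (a 0) m)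

  star-∈-NBnodes : ∀ {z} → z ∈ Bnodes μ → starNode μ z ∈ NBnodes ν
  star-∈-NBnodes z∈ with ∈-Bnodes⁻ z∈
  ... | i , t , i<m , t<a , refl , c≢m with <⊎> (i + suc t) c≢m
  ... | inj₁ c<m rewrite star-upper (suc i) (i + suc t) c<m =
    ∈-NBnodes⁺ (i + suc t) i (<-≤-trans c<m m≤length-D) i<c
      (subst (i <_) (sym (row-upper (i + suc t) c<m)) (<-≤-trans i<c (≤-trans (n≤1+n _) (m≤n+m _ (a (i + suc t))))))
    where
    i<c : i < i + suc t
    i<c = m<m+n i (s≤s z≤n)
  ... | inj₂ m<c rewrite star-lower (suc i) (i + suc t) m<c | +-suc i t =
    ∈-NBnodes⁺ (i + t) i (<-≤-trans (<-≤-trans i+t<a+i (a+i≤a₀ i i<m)) a₀≤length-D)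
      (<-≤-trans i<m (≤-pred m<c))
      (subst (i <_) (sym (row-lower (suc (i + t)) m<c)) (<colsAtLeast (suc (i + t)) i i<m i+t<a+i))
    where
    i+t<a+i : i + t < a i + i
    i+t<a+i = subst (i + t <_) (+-comm i (a i)) (+-monoʳ-< i t<a)

  star-surjective : ∀ {w} → w ∈ NBnodes ν → ∃[ z ] (z ∈ Bnodes μ × starNode μ z ≡ w)
  star-surjective w∈ with ∈-NBnodes⁻ w∈
  ... | r , i , _ , i<r , i<row , refl with r <? m
  ... | yes r<m = (suc i , suc (i + suc u)) , ∈-Bnodes⁺ i u (<-trans i<r r<m) u<a (<⇒≢ r<m ∘ trans (sym i+1+u≡r)) ,
          trans (star-upper (suc i) (i + suc u) (subst (_< m) (sym i+1+u≡r) r<m)) (cong (λ c → (suc c , suc i)) i+1+u≡r)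
    where
    u = r ∸ suc i
    i+1+u≡r : i + suc u ≡ r
    i+1+u≡r = trans (+-suc i u) (m+[n∸m]≡n i<r)
    u<a : u < a i
    u<a = +-cancelˡ-≤ i (suc u) (a i) (subst (i + suc u ≤_) (+-comm (a i) i)
      (subst (_≤ a i + i) (sym i+1+u≡r) (≤-trans (<⇒≤ r<m) (m≤a+i i (<-trans i<r r<m)))))
  ... | no r≮m = (suc i , suc (i + suc u)) , ∈-Bnodes⁺ i u i<m u<a (λ c≡m → <⇒≢ (s≤s m≤r) (trans (sym c≡m) i+1+u≡1+r)) ,
          trans (star-lower (suc i) (i + suc u) (subst (m <_) (sym i+1+u≡1+r) (s≤s m≤r))) (cong (λ c → (c , suc i)) i+1+u≡1+r)
    where
    m≤r = ≮⇒≥ r≮m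
    i<cols : i < colsAtLeast (suc r)
    i<cols = subst (i <_) (row-lower (suc r) (s≤s m≤r)) i<row
    i<m : i < m
    i<m = <-≤-trans i<cols (colsAtLeast-≤ _)
    u = r ∸ i
    i+u≡r : i + u ≡ r
    i+u≡r = m+[n∸m]≡n (<⇒≤ i<r)
    i+1+u≡1+r : i + suc u ≡ suc r
    i+1+u≡1+r = trans (+-suc i u) (cong suc i+u≡r)
    u<a : u < a i
    u<a = +-cancelˡ-< i u (a i) (subst (_< i + a i) (sym i+u≡r)
      (subst (suc r ≤_) (+-comm (a i) i) (<colsAtLeast⁻ (suc r) i i<m i<cols)))

  star-injectiveOn : ∀ {z z′} → z ∈ Bnodes μ → z′ ∈ Bnodes μ → starNode μ z ≡ starNode μ z′ → z ≡ z′
  star-injectiveOn z∈ z′∈ eq with ∈-Bnodes⁻ z∈ | ∈-Bnodes⁻ z′∈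
  ... | i , t , _ , _ , refl , c≢m | i′ , t′ , _ , _ , refl , c′≢m
    with <⊎> (i + suc t) c≢m | <⊎> (i′ + suc t′) c′≢m
  ... | inj₁ c<m | inj₁ c′<m rewrite star-upper (suc i) _ c<m | star-upper (suc i′) _ c′<m =
    cong (λ { (c , r) → (r , c) }) eq
  ... | inj₂ m<c | inj₂ m<c′ rewrite star-lower (suc i) _ m<c | star-lower (suc i′) _ m<c′ =
    cong (λ { (c , r) → (r , suc c) }) eq
  ... | inj₁ c<m | inj₂ m<c′ rewrite star-upper (suc i) _ c<m | star-lower (suc i′) _ m<c′ =
    ⊥-elim (<-irrefl refl (<-≤-trans m<c′ (subst (_≤ m) (cong proj₁ eq) c<m)))
  ... | inj₂ m<c | inj₁ c′<m rewrite star-lower (suc i) _ m<c | star-upper (suc i′) _ c′<m =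
    ⊥-elim (<-irrefl refl (<-≤-trans m<c (subst (_≤ m) (sym (cong proj₁ eq)) c′<m)))

  map-star-↭ : map (starNode μ) (Bnodes μ) ↭ NBnodes ν
  map-star-↭ = ∼bag⇒↭ (unique∧set⇒bag
    (Unique-map-injectiveOn (starNode μ) (Bnodes μ) Unique-Bnodes star-injectiveOn) Unique-NBnodes
    (mk⇔ to from))
    where
    to : ∀ {w} → w ∈ map (starNode μ) (Bnodes μ) → w ∈ NBnodes ν
    to w∈ with ∈-map⁻ (starNode μ) w∈
    ... | z , z∈ , refl = star-∈-NBnodes z∈
    from : ∀ {w} → w ∈ NBnodes ν → w ∈ map (starNode μ) (Bnodes μ)
    from w∈ with star-surjective w∈
    ... | z , z∈ , refl = ∈-map⁺ (starNode μ) z∈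

module StarHooks (μ : List ℕ) (bar : IsBar μ) where
  open ShapeOfD μ bar
  open Star μ bar

  contents-upper : ∀ i → i < m → ContentsSumToOne (handNode ν (suc i , 0)) (footNode ν (0 , suc i))
  contents-upper i i<m rewrite row-upper i i<m | col-upper i i<m = shape (a i) i
    where
    shape : ∀ b i → (b + suc i) + suc i ≡ suc i + (b + i) + 1
    shape = solve-∀

  contents-lower : ∀ c → m < c → ContentsSumToOne (handNode ν (c , 0)) (footNode ν (0 , suc c))
  contents-lower c m<c rewrite row-lower c m<c | col-lower c (<⇒≤ m<c) = shape (colsAtLeast c) c
    where
    shape : ∀ L c → L + suc c ≡ c + L + 1
    shape = solve-∀

  star-hook : ∀ {z} → z ∈ Bnodes μ →
    hookLen ν z ≡ hookLen ν (starNode μ z)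
    × ContentsSumToOne (handNode ν (starNode μ z)) (footNode ν z)
    × ContentsSumToOne (handNode ν z) (footNode ν (starNode μ z))
  star-hook z∈ with ∈-Bnodes⁻ z∈
  ... | i , t , i<m , t<a , refl , c≢m with <⊎> (i + suc t) c≢m
  ... | inj₁ c<m rewrite star-upper (suc i) (i + suc t) c<m =
    hook , contents-upper (i + suc t) c<m , contents-upper i i<m
    where
    c = i + suc t
    c<a+i : c < a i + i
    c<a+i = <-≤-trans (subst (c <_) (+-comm c (a c)) (m<m+n c (a-positive c c<m))) (a+i-anti i c (m≤m+n i (suc t)) c<m)
    hook : hookLen ν (suc i , suc c) ≡ hookLen ν (suc c , suc i)
    hook rewrite row-upper i i<m | col-upper c c<m | row-upper c c<m | col-upper i i<m
               | +-suc (a i) i | +-suc (a c) c =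
      cong (_+ 1) (arm+leg-transpose (a i + i) (a c + c) i c c<a+i (<-≤-trans (m<m+n i (s≤s z≤n)) (m≤n+m c (a c))))
  ... | inj₂ m<c rewrite star-lower (suc i) (i + suc t) m<c =
    hook , contents-lower (i + suc t) m<c , contents-upper i i<m
    where
    c = i + suc t
    hook : hookLen ν (suc i , suc c) ≡ hookLen ν (c , suc i)
    hook rewrite row-upper i i<m | col-lower c (<⇒≤ m<c) | row-lower c m<c | col-upper i i<m | +-suc (a i) i =
      cong (_+ 1) (+-comm (a i + i ∸ c) (colsAtLeast c ∸ suc i))

module AbacusOfD (d-1 : ℕ) (μ : List ℕ) (bar : IsBar μ) where
  open Residues d-1
  open Runners d-1
  open ShapeOfD μ bar

  ν : Partition
  ν = D μ

  Q : ℕ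
  Q = (nzParts ν + d-1) / d

  k : ℕ
  k = kNorm d ν

  nzParts-D : nzParts ν ≡ m + n
  nzParts-D rewrite D-shape = trans (length-filterᵇ-++ (0 <ᵇ_) (applyUpTo upperRow m) (applyUpTo lowerRow n))
    (cong₂ _+_ (trans (length-filterᵇ-applyUpTo (0 <ᵇ_) upperRow m) (count-all _ m upper))
               (trans (length-filterᵇ-applyUpTo (0 <ᵇ_) lowerRow n) (count-all _ n lower)))
    where
    upper : ∀ i → i < m → (0 <ᵇ upperRow i) ≡ true
    upper i _ = cong (0 <ᵇ_) (+-suc (a i) i)
    lower : ∀ t → t < n → (0 <ᵇ lowerRow t) ≡ true
    lower t t<n with 0 <? m
    ... | no  m≯0 = ⊥-elim (n≮0 (subst (t <_) (trans (cong (_∸ m) (a-≥m 0 (≮⇒≥ m≯0))) (0∸n≡0 m)) t<n))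
    ... | yes 0<m = T⇒≡true (<⇒<ᵇ (<colsAtLeast (suc m + t) 0 0<m (subst (suc m + t ≤_) (sym (+-identityʳ (a 0)))
                      (subst (_≤ a 0) (+-suc m t) (subst (m + suc t ≤_) (m+[n∸m]≡n m≤a₀) (+-monoʳ-≤ m t<n))))))
      where
      m≤a₀ : m ≤ a 0
      m≤a₀ = ≤-trans (m≤a+i 0 0<m) (≤-reflexive (+-identityʳ (a 0)))

  m+n≤k : m + n ≤ k
  m+n≤k = subst (_≤ k) nzParts-D (≤-roundUp (nzParts ν))

  m≤k : m ≤ k
  m≤k = ≤-trans (m≤m+n m n) m+n≤k

  a≤k : ∀ i → a i ≤ k
  a≤k i with i <? m
  ... | yes i<m = ≤-trans (m≤m+n (a i) i) (≤-trans (a+i≤a₀ i i<m) (≤-trans (m≤n+m∸n (a 0) m) m+n≤k))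
  ... | no  i≮m = subst (_≤ k) (sym (a-≥m i (≮⇒≥ i≮m))) z≤n

  upperBead lowerBead gap : ℕ → ℕ
  upperBead i = a i + k
  lowerBead t = colsAtLeast (suc (m + t)) + (k ∸ suc (m + t))
  gap i = k ∸ a i

  upperOn lowerOn gapsOn : ℕ → ℕ
  upperOn r = count (onRunner r ∘ upperBead) m
  lowerOn r = count (onRunner r ∘ lowerBead) (k ∸ m)
  gapsOn  r = count (onRunner r ∘ gap) m

  1+m+t≤k : ∀ t → t < k ∸ m → suc (m + t) ≤ k
  1+m+t≤k t t< = subst (suc (m + t) ≤_) (m+[n∸m]≡n m≤k) (+-monoʳ-< m t<)

  beads-D : ∀ r → beads d ν r ≡ upperOn r + lowerOn r
  beads-D r = begin
    beads d ν r
      ≡⟨ cong (length ∘ filterᵇ (onRunner r)) (map-applyUpTo suc (λ s → row ν s + k ∸ s) k) ⟩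
    length (filterᵇ (onRunner r) (applyUpTo (λ j → row ν (suc j) + k ∸ suc j) k))
      ≡⟨ length-filterᵇ-applyUpTo (onRunner r) _ k ⟩
    count (λ j → onRunner r (row ν (suc j) + k ∸ suc j)) k
      ≡⟨ cong (count _) (sym (m+[n∸m]≡n m≤k)) ⟩
    count (λ j → onRunner r (row ν (suc j) + k ∸ suc j)) (m + (k ∸ m))
      ≡⟨ count-+ _ m (k ∸ m) ⟩
    count (λ j → onRunner r (row ν (suc j) + k ∸ suc j)) m
      + count (λ t → onRunner r (row ν (suc (m + t)) + k ∸ suc (m + t))) (k ∸ m)
      ≡⟨ cong₂ _+_ (count-cong _ _ m upper) (count-cong _ _ (k ∸ m) lower) ⟩
    upperOn r + lowerOn r ∎
    where
    open ≡-Reasoning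
    regroup : ∀ b j k → b + suc j + k ≡ suc j + (b + k)
    regroup = solve-∀
    upper : ∀ j → j < m → onRunner r (row ν (suc j) + k ∸ suc j) ≡ onRunner r (upperBead j)
    upper j j<m rewrite row-upper j j<m =
      cong (onRunner r) (trans (cong (_∸ suc j) (regroup (a j) j k)) (m+n∸m≡n (suc j) (a j + k)))
    lower : ∀ t → t < k ∸ m → onRunner r (row ν (suc (m + t)) + k ∸ suc (m + t)) ≡ onRunner r (lowerBead t)
    lower t t< rewrite row-lower (suc (m + t)) (s≤s (m≤m+n m t)) =
      cong (onRunner r) (+-∸-assoc (colsAtLeast (suc (m + t))) (1+m+t≤k t t<))

  lowerBead-< : ∀ t → t < k ∸ m → lowerBead t < k
  lowerBead-< t t< = subst (lowerBead t <_) (m+[n∸m]≡n (1+m+t≤k t t<))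
    (+-monoˡ-< (k ∸ suc (m + t)) (s≤s (≤-trans (colsAtLeast-≤ _) (m≤m+n m t))))

  gap-< : ∀ i → i < m → gap i < k
  gap-< i i<m = ∸-monoʳ-< {k} {a i} {0} (a-positive i i<m) (a≤k i)

  lowerBead≢gap : ∀ t i → t < k ∸ m → i < m → lowerBead t ≢ gap i
  lowerBead≢gap t i t< i<m lower≡gap = absurd (i <? L)
    where
    R = suc (m + t)
    L = colsAtLeast R
    a+L≡R : a i + L ≡ R
    a+L≡R = +-cancelˡ-≡ (k ∸ R) (a i + L) R (begin
      (k ∸ R) + (a i + L)  ≡⟨ regroup (k ∸ R) (a i) L ⟩
      lowerBead t + a i    ≡⟨ cong (_+ a i) lower≡gap ⟩
      (k ∸ a i) + a i      ≡⟨ m∸n+n≡m (a≤k i) ⟩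
      k                    ≡⟨ m∸n+n≡m (1+m+t≤k t t<) ⟨
      (k ∸ R) + R          ∎)
      where
      open ≡-Reasoning
      regroup : ∀ x y z → x + (y + z) ≡ (z + x) + y
      regroup = solve-∀
    absurd : Dec (i < L) → ⊥
    absurd (yes i<L) = <-irrefl refl
      (≤-<-trans (<colsAtLeast⁻ R i i<m i<L) (subst (a i + i <_) a+L≡R (+-monoʳ-< (a i) i<L)))
    absurd (no  i≮L) = i≮L (<colsAtLeast R i i<m (subst (_≤ a i + i) a+L≡R (+-monoʳ-≤ (a i) (≮⇒≥ i≮L))))

  lowerBeads++gaps : List ℕ
  lowerBeads++gaps = applyUpTo lowerBead (k ∸ m) ++ applyUpTo gap m

  lowerBeads++gaps-↭-upTo : lowerBeads++gaps ↭ upTo k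
  lowerBeads++gaps-↭-upTo = unique-⊆-length⇒↭ unique ⊆upTo (≤-reflexive length≡)
    where
    lowerBead-anti : ∀ {t t′} → t < t′ → t′ < k ∸ m → lowerBead t′ < lowerBead t
    lowerBead-anti {t} {t′} t<t′ t′< = +-mono-≤-< (colsAtLeast-anti _ _ (s≤s (+-monoʳ-≤ m (<⇒≤ t<t′))))
      (∸-monoʳ-< (s≤s (+-monoʳ-< m t<t′)) (1+m+t≤k t′ t′<))
    unique : Unique lowerBeads++gaps
    unique = Unique.++⁺
      (Unique.applyUpTo⁺₁ lowerBead (k ∸ m) (λ t<t′ t′< eq → <-irrefl (sym eq) (lowerBead-anti t<t′ t′<)))
      (Unique.applyUpTo⁺₁ gap m (λ {i} {i′} i<i′ i′<m eq → <-irrefl eq (∸-monoʳ-< (a-anti-< i i′ i<i′ i′<m) (a≤k i))))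
      (λ { (p , q) → let (t , t< , e) = ∈-applyUpTo⁻ lowerBead p ; (i , i< , e′) = ∈-applyUpTo⁻ gap q
                     in lowerBead≢gap t i t< i< (trans (sym e) e′) })
    ⊆upTo : ∀ {x} → x ∈ lowerBeads++gaps → x ∈ upTo k
    ⊆upTo x∈ with ∈-++⁻ (applyUpTo lowerBead (k ∸ m)) x∈
    ... | inj₁ p with ∈-applyUpTo⁻ lowerBead p
    ...   | t , t< , refl = ∈-upTo⁺ (lowerBead-< t t<)
    ⊆upTo x∈ | inj₂ q with ∈-applyUpTo⁻ gap q
    ...   | i , i< , refl = ∈-upTo⁺ (gap-< i i<)
    length≡ : length (upTo k) ≡ length lowerBeads++gaps
    length≡ = begin
      length (upTo k)                                                   ≡⟨ length-applyUpTo id k ⟩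
      k                                                                 ≡⟨ m∸n+n≡m m≤k ⟨
      k ∸ m + m                                                         ≡⟨ cong₂ _+_ (length-applyUpTo lowerBead (k ∸ m)) (length-applyUpTo gap m) ⟨
      length (applyUpTo lowerBead (k ∸ m)) + length (applyUpTo gap m)   ≡⟨ length-++ (applyUpTo lowerBead (k ∸ m)) ⟨
      length lowerBeads++gaps                                           ∎
      where open ≡-Reasoning

  lowerOn+gapsOn : ∀ r → r < d → lowerOn r + gapsOn r ≡ Q
  lowerOn+gapsOn r r<d = begin
    lowerOn r + gapsOn r
      ≡⟨ cong₂ _+_ (length-filterᵇ-applyUpTo (onRunner r) lowerBead (k ∸ m)) (length-filterᵇ-applyUpTo (onRunner r) gap m) ⟨
    length (filterᵇ (onRunner r) (applyUpTo lowerBead (k ∸ m))) + length (filterᵇ (onRunner r) (applyUpTo gap m))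
      ≡⟨ length-filterᵇ-++ (onRunner r) (applyUpTo lowerBead (k ∸ m)) _ ⟨
    length (filterᵇ (onRunner r) lowerBeads++gaps)
      ≡⟨ ↭.↭-length (↭.filter-↭ (T? ∘ onRunner r) lowerBeads++gaps-↭-upTo) ⟩
    length (filterᵇ (onRunner r) (upTo k))
      ≡⟨ length-filterᵇ-applyUpTo (onRunner r) id k ⟩
    count (onRunner r) k
      ≡⟨ count-onRunner-multiple r r<d Q ⟩
    Q ∎
    where open ≡-Reasoning

  gap+upperBead≈0 : ∀ i → gap i + upperBead i ≈ 0
  gap+upperBead≈0 i = trans (cong (_% d) gap+upper≡) ([m+kn]%n≡m%n 0 (Q + Q) d)
    where
    double : ∀ d Q → d * Q + d * Q ≡ 0 + (Q + Q) * d
    double = solve-∀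
    gap+upper≡ : gap i + upperBead i ≡ 0 + (Q + Q) * d
    gap+upper≡ = trans (sym (+-assoc (k ∸ a i) (a i) k)) (trans (cong (_+ k) (m∸n+n≡m (a≤k i))) (double d Q))

  gapsOn≡upperOn : ∀ r s → r < d → s < d → r + s ≈ 0 → gapsOn r ≡ upperOn s
  gapsOn≡upperOn r s r<d s<d r+s≈0 =
    count-cong _ _ m (λ i _ → onRunner-complement (gap i) (upperBead i) r s r<d s<d (trans (gap+upperBead≈0 i) (sym r+s≈0)))

  beads+gapsOn : ∀ r → r < d → beads d ν r + gapsOn r ≡ Q + upperOn r
  beads+gapsOn r r<d = begin
    beads d ν r + gapsOn r              ≡⟨ cong (_+ gapsOn r) (beads-D r) ⟩
    upperOn r + lowerOn r + gapsOn r    ≡⟨ +-assoc (upperOn r) (lowerOn r) (gapsOn r) ⟩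
    upperOn r + (lowerOn r + gapsOn r)  ≡⟨ cong (upperOn r +_) (lowerOn+gapsOn r r<d) ⟩
    upperOn r + Q                       ≡⟨ +-comm (upperOn r) Q ⟩
    Q + upperOn r                       ∎
    where open ≡-Reasoning

  beads-+-starRes : ∀ r → r < d → beads d ν r + beads d ν (starRes d r) ≡ Q + Q
  beads-+-starRes r r<d = +-balance (beads d ν r) (beads d ν r*) (upperOn r*) (upperOn r) Q
    (trans (cong (beads d ν r +_) (sym (gapsOn≡upperOn r r* r<d r*<d r+r*≈0))) (beads+gapsOn r r<d))
    (trans (cong (beads d ν r* +_) (sym (gapsOn≡upperOn r* r r*<d r<d (starRes-+ r r<d)))) (beads+gapsOn r* r*<d))
    where
    r* = starRes d r
    r*<d = starRes-< r
    r+r*≈0 : r + r* ≈ 0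
    r+r*≈0 = trans (cong (_% d) (+-comm r r*)) (starRes-+ r r<d)

module Corollary (d-1 : ℕ) (lam q : List ℕ) (bar-lam : IsBar lam) (bar-q : IsBar q) where
  open Residues d-1
  open Star q bar-q using (map-star-↭)
  open StarHooks q bar-q using (star-hook)
  open AbacusOfD d-1 lam bar-lam using (Q; beads-+-starRes)

  ν : Partition
  ν = D q

  x : ℕ → ℕ
  x = beads d (D lam)

  hbar-star : ∀ z → z ∈ Bnodes q → hbar d lam q z ≡ hbar d lam q (starNode q z)
  hbar-star z z∈ with star-hook z∈
  ... | hook≡ , contents* , contents = cong₂ (λ h w → ℤ.+ h ℤ.+ w ℤ.* ℤ.+ d) hook≡ runners≡
    where
    z* = starNode q z
    j = predRes (footRes d ν z)
    j′ = predRes (footRes d ν z*)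
    hand*≡ : handRes d ν z* ≡ starRes d j
    hand*≡ = ≡-starRes-predRes (res-< (handNode ν z*)) (contents-res (handNode ν z*) (footNode ν z) contents*)
    hand≡ : handRes d ν z ≡ starRes d j′
    hand≡ = ≡-starRes-predRes (res-< (handNode ν z)) (contents-res (handNode ν z) (footNode ν z*) contents)
    balanced : x (starRes d j′) + x j′ ≡ x (starRes d j) + x j
    balanced = begin
      x (starRes d j′) + x j′  ≡⟨ +-comm (x (starRes d j′)) (x j′) ⟩
      x j′ + x (starRes d j′)  ≡⟨ beads-+-starRes j′ (predRes-< (footRes d ν z*)) ⟩
      Q + Q                    ≡⟨ beads-+-starRes j (predRes-< (footRes d ν z)) ⟨
      x j + x (starRes d j)    ≡⟨ +-comm (x j) (x (starRes d j)) ⟩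
      x (starRes d j) + x j    ∎
      where open ≡-Reasoning
    runners≡ : ℤ.+ x (handRes d ν z) ℤ.- ℤ.+ x j ≡ ℤ.+ x (handRes d ν z*) ℤ.- ℤ.+ x j′
    runners≡ rewrite hand*≡ | hand≡ = m-n≡o-p (x (starRes d j′)) (x j) (x (starRes d j)) (x j′) balanced

  inH-star : ∀ i j → i < d → j < d → ∀ z → z ∈ Bnodes q →
    inH d ν (starRes d j) (starRes d i) (starNode q z) ≡ inH d ν i j z
  inH-star i j i<d j<d z z∈ with star-hook z∈
  ... | _ , contents* , contents = trans
    (cong₂ _∧_
      (≡ᵇ-complement (res-< (handNode ν z*)) (res-< (footNode ν z)) (starRes-< j) (sucRes-< j)
        (trans (contents-res (handNode ν z*) (footNode ν z) contents*) (sym (starRes-+-sucRes j j<d))))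
      (sym (≡ᵇ-complement (res-< (handNode ν z)) (res-< (footNode ν z*)) i<d (sucRes-< (starRes d i))
        (trans (contents-res (handNode ν z) (footNode ν z*) contents) (sym (+-sucRes-starRes i i<d))))))
    (∧-comm (footRes d ν z ≡ᵇ sucRes j) (handRes d ν z ≡ᵇ i))
    where
    z* = starNode q z

  Bij↭NBij : ∀ i j → i < d → j < d →
    map (hbar d lam q) (Bij d q i j) ↭ map (hbar d lam q) (NBij d q (starRes d j) (starRes d i))
  Bij↭NBij i j i<d j<d = map-filterᵇ-↭-transport (starNode q) (inH d ν i j) (inH d ν (starRes d j) (starRes d i))
    (hbar d lam q) (Bnodes q) (NBnodes ν) map-star-↭ (inH-star i j i<d j<d) (λ z z∈ → sym (hbar-star z z∈))

corollary3p4 : (d : ℕ) .{{_ : NonZero d}} → 3 ≤ d → d % 2 ≡ 1 →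
    (lam q : List ℕ) → IsBar lam → IsBar q →
    EmptyCore d (D q) → quotient d (D q) ≡ quotient d (D lam) →
    ((z : Node) → z ∈ Bnodes q → hbar d lam q z ≡ hbar d lam q (starNode q z))
    × ((i j : ℕ) → i < d → j < d →
    map (hbar d lam q) (Bij d q i j) ↭ map (hbar d lam q) (NBij d q (starRes d j) (starRes d i)))
corollary3p4 (suc d-1) _ _ lam q bar-lam bar-q _ _ =
  Corollary.hbar-star d-1 lam q bar-lam bar-q , Corollary.Bij↭NBij d-1 lam q bar-lam bar-q
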